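{- For every permutation $\sigma\in\mathfrak{S}_n$: (a) $\mathrm{wexx}(\sigma)=\mathrm{nrfix}(\sigma)+\mathrm{nrcval}(\sigma)+\mathrm{nrcdrise}(\sigma)$; (b) $\mathrm{cdes}(\sigma)=\mathrm{nminval}(\sigma)+\mathrm{cdfall}(\sigma)$.
   Context: $\mathfrak{S}_n$ is the set of permutations of $[n]$. $\mathrm{wexx}(\sigma)$ is the number of $j\in[n]$ with $j\le\sigma(j)$ for which there exist $i<j<k$ with $\sigma(i)>\sigma(j)>\sigma(k)$. $\mathrm{cdes}(\sigma)$ is the number of $i\in[n]$ with $i>\sigma(i)$ such that $\sigma(i)$ is not the smallest element of its cycle. For $i\in[n]$: cycle valley if $\sigma^{ -1}(i)>i<\sigma(i)$, cycle double rise if $\sigma^{ -1}(i)<i<\sigma(i)$, cycle double fall if $\sigma^{ -1}(i)>i>\sigma(i)$, fixed point if $\sigma(i)=i$. $i$ is a record if $\sigma(j)<\sigma(i)$ for all $j<i$, an antirecord if $\sigma(j)>\sigma(i)$ for all $j>i$, and a neither-record-antirecord if it is neither. nrfix, nrcval, nrcdrise = number of fixed points, cycle valleys, cycle double rises that are neither-record-antirecords; nminval = number of cycle valleys that are not the smallest element of their cycle; cdfall = number of cycle double falls. -}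

module Defs where

open import Data.Nat using (ℕ; zero; suc; _<ᵇ_; _≡ᵇ_)
open import Data.Bool using (Bool; true; false; _∧_; _∨_; not)
open import Data.Fin using (Fin; toℕ)
open import Data.List using (List; length; filterᵇ; allFin)
open import Data.Bool.ListAction using (any; all)
open import Data.Fin.Permutation using (Permutation′; _⟨$⟩ʳ_; _⟨$⟩ˡ_)

-- Permutations of [n] are modelled as permutations of Fin n = {0,…,n-1};
-- every notion below only uses the order of positions/values, so the shift
-- by one relative to [n] = {1,…,n} is immaterial.

count : ∀ {n} → (Fin n → Bool) → ℕ
count {n} P = length (filterᵇ P (allFin n))

_<F_ : ∀ {n} → Fin n → Fin n → Bool
a <F b = toℕ a <ᵇ toℕ b

_≤F_ : ∀ {n} → Fin n → Fin n → Bool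
a ≤F b = not (b <F a)

_=F_ : ∀ {n} → Fin n → Fin n → Bool
a =F b = toℕ a ≡ᵇ toℕ b

module _ {n : ℕ} (σ : Permutation′ n) where

  app : Fin n → Fin n
  app i = σ ⟨$⟩ʳ i

  inv : Fin n → Fin n
  inv i = σ ⟨$⟩ˡ i

  iter : ℕ → Fin n → Fin n
  iter zero x = x
  iter (suc k) x = app (iter k x)

  -- x is the smallest element of its cycle {σ^k(x) : k ∈ ℕ};
  -- since the cycle has at most n elements, k ranging over 0..n suffices.
  isCycleMin : Fin n → Bool
  isCycleMin x = go n
    where
    go : ℕ → Bool
    go zero = true
    go (suc k) = (x ≤F iter (suc k) x) ∧ go k

  isRecord : Fin n → Bool
  isRecord i = all (λ j → not (j <F i) ∨ (app j <F app i)) (allFin n)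

  isAntirecord : Fin n → Bool
  isAntirecord i = all (λ j → not (i <F j) ∨ (app i <F app j)) (allFin n)

  isNRA : Fin n → Bool
  isNRA i = not (isRecord i) ∧ not (isAntirecord i)

  isFix : Fin n → Bool
  isFix i = app i =F i

  isCVal : Fin n → Bool
  isCVal i = (i <F inv i) ∧ (i <F app i)

  isCDRise : Fin n → Bool
  isCDRise i = (inv i <F i) ∧ (i <F app i)

  isCDFall : Fin n → Bool
  isCDFall i = (i <F inv i) ∧ (app i <F i)

  isWexx : Fin n → Bool
  isWexx j = (j ≤F app j)
           ∧ any (λ i → (i <F j) ∧ (app j <F app i)) (allFin n)
           ∧ any (λ k → (j <F k) ∧ (app k <F app j)) (allFin n)

  wexx : ℕ
  wexx = count isWexx

  cdes : ℕ
  cdes = count (λ i → (app i <F i) ∧ not (isCycleMin (app i)))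

  nrfix : ℕ
  nrfix = count (λ i → isFix i ∧ isNRA i)

  nrcval : ℕ
  nrcval = count (λ i → isCVal i ∧ isNRA i)

  nrcdrise : ℕ
  nrcdrise = count (λ i → isCDRise i ∧ isNRA i)

  nminval : ℕ
  nminval = count (λ i → isCVal i ∧ not (isCycleMin i))

  cdfall : ℕ
  cdfall = count isCDFall

-- An earlier larger value exists at j iff j is not a record, and a later smaller
-- value iff j is not an antirecord (σ is injective), so wexx counts the weak
-- excedances j ≤ σ(j) that are neither records nor antirecords. A weak excedance
-- is a fixed point or an excedance, and an excedance j < σ(j) is a cycle valley or
-- a cycle double rise according as σ⁻¹(j) > j or σ⁻¹(j) < j, since σ⁻¹ has the
-- same fixed points as σ.
-- For (b) substitute j = σ(i): cdes counts the j < σ⁻¹(j) that are not cycle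
-- minima. These are the non-minimal cycle valleys and the cycle double falls, and
-- a cycle double fall is never a cycle minimum because σ(j) < j.
module Submission where

open import Defs
open import Data.Bool using (Bool; true; false; T; _∧_; _∨_; not)
open import Data.Bool.ListAction using (any; all)
open import Data.Bool.Properties
  using (∧-identityʳ; ∧-zeroʳ; ∧-comm; not-involutive; T-≡; T-∧; ∨-∧-booleanAlgebra)
open import Data.Empty using (⊥-elim)
open import Data.Fin using (Fin; toℕ)
open import Data.Fin.Permutation using (Permutation′; _⟨$⟩ʳ_; inverseˡ; inverseʳ)
open import Data.Fin.Properties using (toℕ-injective)
open import Data.List using ([]; _∷_; length; filterᵇ; allFin; tabulate)
open import Data.Nat using (ℕ; zero; suc; _+_; _<ᵇ_; _≡ᵇ_)
open import Data.Nat.Properties using (+-assoc; <ᵇ⇒<; <⇒≢; +-0-commutativeMonoid)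
open import Data.Product using (_×_; _,_; proj₂)
open import Function using (_∘_; Equivalence)
open import Relation.Binary.PropositionalEquality
  using (_≡_; _≢_; refl; sym; trans; cong; cong₂; subst₂; module ≡-Reasoning)

open import Algebra.Lattice.Properties.BooleanAlgebra ∨-∧-booleanAlgebra using (deMorgan₁; deMorgan₂)
open import Algebra.Properties.CommutativeMonoid.Sum +-0-commutativeMonoid
  using (sum; sum-cong-≗; sum-permute; ∑-distrib-+)

open ≡-Reasoning

⟦_⟧ : Bool → ℕ
⟦ true ⟧ = 1
⟦ false ⟧ = 0

data Partition : Bool → Bool → Bool → Set where
  neither : Partition false false false
  left    : Partition true  true  false
  right   : Partition true  false true

Partition-⟦⟧ : ∀ {a b c} → Partition a b c → ⟦ a ⟧ ≡ ⟦ b ⟧ + ⟦ c ⟧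
Partition-⟦⟧ neither = refl
Partition-⟦⟧ left    = refl
Partition-⟦⟧ right   = refl

Partition-∧ʳ : ∀ {a b c} → Partition a b c → ∀ d → Partition (a ∧ d) (b ∧ d) (c ∧ d)
Partition-∧ʳ neither _     = neither
Partition-∧ʳ left    true  = left
Partition-∧ʳ left    false = neither
Partition-∧ʳ right   true  = right
Partition-∧ʳ right   false = neither

∧-congˡ : ∀ a {b c} → (T a → b ≡ c) → a ∧ b ≡ a ∧ c
∧-congˡ true  b≡c = b≡c _
∧-congˡ false _   = refl

any≡not-all : ∀ {A : Set} {f g : A → Bool} → (∀ x → f x ≡ not (g x)) →
              ∀ xs → any f xs ≡ not (all g xs)
any≡not-all f≡not-g []       = refl
any≡not-all {g = g} f≡not-g (x ∷ xs) =
  trans (cong₂ _∨_ (f≡not-g x) (any≡not-all f≡not-g xs)) (sym (deMorgan₁ (g x) (all g xs)))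

<ᵇ⇒≢ : ∀ {m n} → T (m <ᵇ n) → m ≢ n
<ᵇ⇒≢ {m} {n} m<ᵇn = <⇒≢ (<ᵇ⇒< m n m<ᵇn)

<ᵇ-flip : ∀ {m n} → m ≢ n → (n <ᵇ m) ≡ not (m <ᵇ n)
<ᵇ-flip {zero}  {zero}  m≢n = ⊥-elim (m≢n refl)
<ᵇ-flip {zero}  {suc n} _   = refl
<ᵇ-flip {suc m} {zero}  _   = refl
<ᵇ-flip {suc m} {suc n} m≢n = <ᵇ-flip (m≢n ∘ cong suc)

Partition-≤ᵇ : ∀ m n → Partition (not (n <ᵇ m)) (n ≡ᵇ m) (m <ᵇ n)
Partition-≤ᵇ zero    zero    = left
Partition-≤ᵇ zero    (suc n) = right
Partition-≤ᵇ (suc m) zero    = neither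
Partition-≤ᵇ (suc m) (suc n) = Partition-≤ᵇ m n

Partition-≢ : ∀ {m n} → m ≢ n → Partition true (m <ᵇ n) (n <ᵇ m)
Partition-≢ {m} {n} m≢n rewrite <ᵇ-flip m≢n with m <ᵇ n
... | true  = left
... | false = right

Partition-<ᵇ : ∀ b {m n} → (T b → m ≢ n) → Partition b (b ∧ (m <ᵇ n)) (b ∧ (n <ᵇ m))
Partition-<ᵇ false _   = neither
Partition-<ᵇ true  m≢n = Partition-≢ (m≢n _)

length-filterᵇ-tabulate : ∀ {A : Set} {n} (P : A → Bool) (f : Fin n → A) →
                          length (filterᵇ P (tabulate f)) ≡ sum (⟦_⟧ ∘ P ∘ f)
length-filterᵇ-tabulate {n = zero}  P f = refl
length-filterᵇ-tabulate {n = suc n} P f with P (f Fin.zero)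
... | true  = cong suc (length-filterᵇ-tabulate P (f ∘ Fin.suc))
... | false = length-filterᵇ-tabulate P (f ∘ Fin.suc)

count≡∑ : ∀ {n} (P : Fin n → Bool) → count P ≡ sum (⟦_⟧ ∘ P)
count≡∑ P = length-filterᵇ-tabulate P (λ i → i)

count-cong : ∀ {n} {P Q : Fin n → Bool} → (∀ i → P i ≡ Q i) → count P ≡ count Q
count-cong {P = P} {Q} P≡Q =
  trans (count≡∑ P) (trans (sum-cong-≗ (cong ⟦_⟧ ∘ P≡Q)) (sym (count≡∑ Q)))

count-split : ∀ {n} {P Q R : Fin n → Bool} → (∀ i → Partition (P i) (Q i) (R i)) →
              count P ≡ count Q + count R
count-split {P = P} {Q} {R} partition = begin
  count P                        ≡⟨ count≡∑ P ⟩
  sum (⟦_⟧ ∘ P)                  ≡⟨ sum-cong-≗ (Partition-⟦⟧ ∘ partition) ⟩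
  sum (λ i → ⟦ Q i ⟧ + ⟦ R i ⟧)  ≡⟨ ∑-distrib-+ (⟦_⟧ ∘ Q) (⟦_⟧ ∘ R) ⟩
  sum (⟦_⟧ ∘ Q) + sum (⟦_⟧ ∘ R)  ≡⟨ sym (cong₂ _+_ (count≡∑ Q) (count≡∑ R)) ⟩
  count Q + count R              ∎

count-∘-permute : ∀ {n} (π : Permutation′ n) (P : Fin n → Bool) → count (P ∘ (π ⟨$⟩ʳ_)) ≡ count P
count-∘-permute π P =
  trans (count≡∑ (P ∘ (π ⟨$⟩ʳ_))) (trans (sym (sum-permute (⟦_⟧ ∘ P) π)) (sym (count≡∑ P)))

-- The loop inside isCycleMin is not in scope; cycleMinLoop names it as the solution
-- of the unification problem in isCycleMin-unfold, which abstracting over suc m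
-- turns into a pattern.
mutual
  cycleMinLoop : ∀ {n} → Permutation′ n → Fin n → ℕ → Bool
  cycleMinLoop = _

  isCycleMin-unfold : ∀ {m} (σ : Permutation′ (suc m)) x →
                      isCycleMin σ x ≡ (x ≤F iter σ (suc m) x) ∧ cycleMinLoop σ x m
  isCycleMin-unfold {m} σ x with suc m
  ... | _ = refl

cycleMinLoop-descent : ∀ {n} (σ : Permutation′ n) {x} → T (app σ x <F x) →
                       ∀ k → cycleMinLoop σ x (suc k) ≡ false
cycleMinLoop-descent σ σx<x zero    rewrite Equivalence.to T-≡ σx<x = refl
cycleMinLoop-descent σ {x} σx<x (suc k) =
  trans (cong ((x ≤F iter σ (suc (suc k)) x) ∧_) (cycleMinLoop-descent σ σx<x k)) (∧-zeroʳ _)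

isCycleMin-descent : ∀ {n} (σ : Permutation′ n) {x} → T (app σ x <F x) → isCycleMin σ x ≡ false
isCycleMin-descent {suc m} σ {x} σx<x =
  trans (isCycleMin-unfold σ x) (cycleMinLoop-descent σ σx<x m)

module _ {n : ℕ} (σ : Permutation′ n) where

  app-toℕ-injective : ∀ {p q} → toℕ (app σ p) ≡ toℕ (app σ q) → toℕ p ≡ toℕ q
  app-toℕ-injective {p} {q} σp≡σq = cong toℕ (begin
    p                       ≡⟨ sym (inverseˡ σ) ⟩
    inv σ (app σ p)         ≡⟨ cong (inv σ) (toℕ-injective σp≡σq) ⟩
    inv σ (app σ q)         ≡⟨ inverseˡ σ ⟩
    q                       ∎)

  inversion≡not-noninversion : ∀ p q → (p <F q) ∧ (app σ q <F app σ p) ≡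
                                       not (not (p <F q) ∨ (app σ p <F app σ q))
  inversion≡not-noninversion p q = begin
    (p <F q) ∧ (σq <F σp)
      ≡⟨ ∧-congˡ (p <F q) (λ p<q → <ᵇ-flip (<ᵇ⇒≢ p<q ∘ app-toℕ-injective)) ⟩
    (p <F q) ∧ not (σp <F σq)
      ≡⟨ cong (_∧ not (σp <F σq)) (sym (not-involutive (p <F q))) ⟩
    not (not (p <F q)) ∧ not (σp <F σq)
      ≡⟨ sym (deMorgan₂ (not (p <F q)) (σp <F σq)) ⟩
    not (not (p <F q) ∨ (σp <F σq)) ∎
    where
    σp σq : Fin n
    σp = app σ p
    σq = app σ q

  isWexx≡weakExcedance∧isNRA : ∀ j → isWexx σ j ≡ (j ≤F app σ j) ∧ isNRA σ j
  isWexx≡weakExcedance∧isNRA j = cong₂ (λ l r → (j ≤F app σ j) ∧ l ∧ r)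
    (any≡not-all (λ i → inversion≡not-noninversion i j) (allFin n))
    (any≡not-all (λ k → inversion≡not-noninversion j k) (allFin n))

  excedance⇒toℕ≢inv : ∀ {j} → T (j <F app σ j) → toℕ j ≢ toℕ (inv σ j)
  excedance⇒toℕ≢inv {j} j<σj j≡σ⁻¹j = <ᵇ⇒≢ j<σj (cong toℕ (begin
    j               ≡⟨ sym (inverseʳ σ) ⟩
    app σ (inv σ j) ≡⟨ cong (app σ) (sym (toℕ-injective j≡σ⁻¹j)) ⟩
    app σ j         ∎))

  inv-excedance⇒toℕ≢app : ∀ {j} → T (j <F inv σ j) → toℕ j ≢ toℕ (app σ j)
  inv-excedance⇒toℕ≢app {j} j<σ⁻¹j j≡σj = <ᵇ⇒≢ j<σ⁻¹j (cong toℕ (begin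
    j               ≡⟨ sym (inverseˡ σ) ⟩
    inv σ (app σ j) ≡⟨ cong (inv σ) (sym (toℕ-injective j≡σj)) ⟩
    inv σ j         ∎))

  excedance-partition : ∀ j → Partition (j <F app σ j) (isCVal σ j) (isCDRise σ j)
  excedance-partition j =
    subst₂ (Partition (j <F app σ j)) (∧-comm (j <F app σ j) (j <F inv σ j))
      (∧-comm (j <F app σ j) (inv σ j <F j))
      (Partition-<ᵇ (j <F app σ j) (excedance⇒toℕ≢inv {j}))

  inv-excedance-partition : ∀ j → Partition (j <F inv σ j) (isCVal σ j) (isCDFall σ j)
  inv-excedance-partition j = Partition-<ᵇ (j <F inv σ j) (inv-excedance⇒toℕ≢app {j})

  isCDFall∧not-isCycleMin : ∀ j → isCDFall σ j ∧ not (isCycleMin σ j) ≡ isCDFall σ j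
  isCDFall∧not-isCycleMin j = trans
    (∧-congˡ (isCDFall σ j) (cong not ∘ isCycleMin-descent σ ∘ proj₂ ∘ Equivalence.to T-∧))
    (∧-identityʳ (isCDFall σ j))

  wexx≡nrfix+nrcval+nrcdrise : wexx σ ≡ nrfix σ + nrcval σ + nrcdrise σ
  wexx≡nrfix+nrcval+nrcdrise = begin
    wexx σ
      ≡⟨ count-cong isWexx≡weakExcedance∧isNRA ⟩
    count (λ j → (j ≤F app σ j) ∧ isNRA σ j)
      ≡⟨ count-split (λ j → Partition-∧ʳ (Partition-≤ᵇ (toℕ j) (toℕ (app σ j))) (isNRA σ j)) ⟩
    nrfix σ + count (λ j → (j <F app σ j) ∧ isNRA σ j)
      ≡⟨ cong (nrfix σ +_) (count-split (λ j → Partition-∧ʳ (excedance-partition j) (isNRA σ j))) ⟩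
    nrfix σ + (nrcval σ + nrcdrise σ)
      ≡⟨ sym (+-assoc (nrfix σ) (nrcval σ) (nrcdrise σ)) ⟩
    nrfix σ + nrcval σ + nrcdrise σ ∎

  cdes≡nminval+cdfall : cdes σ ≡ nminval σ + cdfall σ
  cdes≡nminval+cdfall = begin
    cdes σ
      ≡⟨ count-cong (λ i → cong (λ k → (app σ i <F k) ∧ not (isCycleMin σ (app σ i))) (sym (inverseˡ σ))) ⟩
    count (nonMinInvExcedance ∘ app σ)
      ≡⟨ count-∘-permute σ nonMinInvExcedance ⟩
    count nonMinInvExcedance
      ≡⟨ count-split (λ j → Partition-∧ʳ (inv-excedance-partition j) (not (isCycleMin σ j))) ⟩
    nminval σ + count (λ j → isCDFall σ j ∧ not (isCycleMin σ j))
      ≡⟨ cong (nminval σ +_) (count-cong isCDFall∧not-isCycleMin) ⟩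
    nminval σ + cdfall σ ∎
    where
    nonMinInvExcedance : Fin n → Bool
    nonMinInvExcedance j = (j <F inv σ j) ∧ not (isCycleMin σ j)

lemma3p8 : (n : ℕ) (σ : Permutation′ n) →
    (wexx σ ≡ nrfix σ + nrcval σ + nrcdrise σ) × (cdes σ ≡ nminval σ + cdfall σ)
lemma3p8 n σ = wexx≡nrfix+nrcval+nrcdrise σ , cdes≡nminval+cdfall σ
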